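{- Let $\alpha_1,\dots,\alpha_n\in\mathbb{Q}^d$ be linearly independent, $A=(\alpha_1,\dots,\alpha_n)$, $K=\mathscr{C}(A)$. Let $1\le r\le n$ and $\gamma=\sum_{i=1}^r k_i\alpha_i$ with $k_i>0$ for all $i$. For $1\le i\le r$ let $$K_i=\Big\{t_i\gamma+\sum_{l\ne i}t_l\alpha_l : t_l>0 \text{ for } 1\le l\le i-1,\ t_l\ge0 \text{ otherwise (including } t_i\ge 0)\Big\}.$$ Then $\sigma(K)=\sum_{i=1}^r\sigma(K_i)$.
   Context: For $S\subset\mathbb{R}^d$, $\sigma(S;\mathbf{y})=\sum_{\mathbf{m}\in S\cap\mathbb{Z}^d}\mathbf{y}^{\mathbf{m}}$ (identified with the rational function it represents when $S$ is a rational polyhedron, possibly half-open). $\mathscr{C}(A)=\{\sum_i k_i\alpha_i: k_i\ge0\}$. (In the paper's notation $K_i=\mathscr{C}^{[i-1]}(A[(i\to\gamma)])$.) -}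

module Defs where

open import Data.Nat using (ℕ; zero; suc) renaming (_≤_ to _≤ℕ_; _<_ to _<ℕ_)
open import Data.Fin using (Fin; zero; suc; toℕ; inject≤; _≟_)
open import Data.Integer using (ℤ)
open import Data.Rational using (ℚ; 0ℚ; _+_; _*_; _≤_; _<_; _/_)
open import Data.Product using (Σ; ∃; _×_)
open import Relation.Binary.PropositionalEquality using (_≡_)
open import Relation.Nullary using (does)
open import Data.Bool using (if_then_else_)

Pt : ℕ → Set
Pt d = Fin d → ℚ

ZPt : ℕ → Set
ZPt d = Fin d → ℤ

toℚ : ∀ {d} → ZPt d → Pt d
toℚ m j = m j / 1

sumFin : ∀ {n} → (Fin n → ℚ) → ℚ
sumFin {zero}  f = 0ℚ
sumFin {suc n} f = f zero + sumFin (λ i → f (suc i))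

lc : ∀ {d n} → (Fin n → ℚ) → (Fin n → Pt d) → Pt d
lc t α j = sumFin (λ l → t l * α l j)

LinIndep : ∀ {d n} → (Fin n → Pt d) → Set
LinIndep {d} {n} α = (c : Fin n → ℚ) → (∀ j → lc c α j ≡ 0ℚ) → ∀ l → c l ≡ 0ℚ

InCone : ∀ {d n} → (Fin n → Pt d) → Pt d → Set
InCone {d} {n} α x = Σ (Fin n → ℚ) λ t → (∀ l → 0ℚ ≤ t l) × (∀ j → x j ≡ lc t α j)

-- γ = Σ_{i=1}^r k_i α_i   (indices 1..r are the first r of Fin n)
gamma : ∀ {d n r} → r ≤ℕ n → (Fin n → Pt d) → (Fin r → ℚ) → Pt d
gamma {r = r} r≤n α k j = sumFin {r} (λ l → k l * α (inject≤ l r≤n) j)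

dropAt : ∀ {n} → Fin n → (Fin n → ℚ) → (Fin n → ℚ)
dropAt i t l = if does (l ≟ i) then 0ℚ else t l

InKi : ∀ {d n r} → r ≤ℕ n → (Fin n → Pt d) → (Fin r → ℚ) → Fin r → Pt d → Set
InKi {d} {n} r≤n α k i x =
  Σ (Fin n → ℚ) λ t →
    (∀ l → toℕ l <ℕ toℕ i → 0ℚ < t l) ×
    (∀ l → 0ℚ ≤ t l) ×
    (∀ j → x j ≡ t (inject≤ i r≤n) * gamma r≤n α k j + lc (dropAt (inject≤ i r≤n) t) α j)

-- Coefficientwise equality of generating functions  σ(S) = Σ_{i} σ(S_i):
-- the coefficient of y^m in σ(S) is [m ∈ S], so the identity says that for every
-- m ∈ ℤ^d, [m ∈ S] = Σ_i [m ∈ S_i], i.e. if m ∈ S then m lies in exactly one S_i,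
-- and if m lies in some S_i then m ∈ S.
σ-sum-eq : ∀ {d r} → (Pt d → Set) → (Fin r → Pt d → Set) → Set
σ-sum-eq {d} {r} S Ss =
  (m : ZPt d) →
    (S (toℚ m) → Σ (Fin r) λ i → Ss i (toℚ m) × (∀ i' → Ss i' (toℚ m) → i' ≡ i)) ×
    (∀ i → Ss i (toℚ m) → S (toℚ m))

{-# OPTIONS --safe #-}

-- By linear independence a point x of K has unique coefficients c, with x = Σ c_l α_l.
-- Put ρ_l = c_l / k_l for l ≤ r.  Then x ∈ K_i exactly when i is the first index at
-- which ρ attains its minimum: x - ρ_i γ has coefficients c_l - ρ_i k_l, which are
-- nonnegative, vanish at i, and are positive for l < i precisely because the minimum is
-- not attained before i.  A first minimiser exists and is unique, so K is the disjoint
-- union of the K_i, which is the coefficientwise identity σ(K) = Σ σ(K_i).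

module Submission where

open import Defs
open import Algebra.Bundles using (Ring)
open import Data.Fin using (Fin; zero; suc; toℕ; inject≤; _≟_)
import Data.Fin.Properties as Fin
open import Data.Nat as ℕ using (ℕ; zero; suc; z≤n; s≤s; _≤_)
import Data.Nat.Properties as ℕ
open import Data.Product using (Σ-syntax; ∃; _×_; _,_; proj₁)
open import Data.Rational as ℚ using (ℚ; 0ℚ; 1ℚ; _+_; _*_; -_; _-_; _÷_; 1/_; _<_; Positive; NonNegative; NonZero)
import Data.Rational.Properties as ℚ
open import Data.Rational.Solver using (module +-*-Solver)
open import Data.Vec.Functional using (updateAt)
open import Data.Vec.Functional.Properties using (updateAt-updates; updateAt-minimal)
open import Function using (_∘_; const)
open import Relation.Binary.PropositionalEquality
open import Relation.Nullary using (yes; no; ¬_; contradiction)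
open import Relation.Nullary.Decidable using (dec-true; dec-false)

open import Algebra.Properties.Semiring.Sum (Ring.semiring ℚ.+-*-ring)
  using (sum; sum-cong-≗; sum-replicate-zero; ∑-distrib-+; *-distribˡ-sum)
open import Algebra.Properties.Group ℚ.+-0-group using (x∙y⁻¹≈ε⇒x≈y; x≈y⇒x∙y⁻¹≈ε)
open import Algebra.Properties.Ring ℚ.+-*-ring using (-1*x≈-x)
open +-*-Solver using (solve; _:+_; _:*_; :-_; _:=_)

sumFin≡sum : ∀ {n} (f : Fin n → ℚ) → sumFin f ≡ sum f
sumFin≡sum {zero}  f = refl
sumFin≡sum {suc n} f = cong (f zero +_) (sumFin≡sum (f ∘ suc))

module _ {d n : ℕ} (α : Fin n → Pt d) where

  lc≡sum : ∀ (a : Fin n → ℚ) j → lc a α j ≡ sum (λ l → a l * α l j)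
  lc≡sum a j = sumFin≡sum (λ l → a l * α l j)

  lc-cong : ∀ {a b : Fin n → ℚ} → (∀ l → a l ≡ b l) → ∀ j → lc a α j ≡ lc b α j
  lc-cong {a} {b} a≗b j = begin
    lc a α j                 ≡⟨ lc≡sum a j ⟩
    sum (λ l → a l * α l j)  ≡⟨ sum-cong-≗ (λ l → cong (_* α l j) (a≗b l)) ⟩
    sum (λ l → b l * α l j)  ≡⟨ sym (lc≡sum b j) ⟩
    lc b α j                 ∎
    where open ≡-Reasoning

  lc-distrib-+ : ∀ (a b : Fin n → ℚ) j → lc (λ l → a l + b l) α j ≡ lc a α j + lc b α j
  lc-distrib-+ a b j = begin
    lc (λ l → a l + b l) α j                           ≡⟨ lc≡sum (λ l → a l + b l) j ⟩
    sum (λ l → (a l + b l) * α l j)                    ≡⟨ sum-cong-≗ (λ l → ℚ.*-distribʳ-+ (α l j) (a l) (b l)) ⟩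
    sum (λ l → a l * α l j + b l * α l j)              ≡⟨ ∑-distrib-+ (λ l → a l * α l j) (λ l → b l * α l j) ⟩
    sum (λ l → a l * α l j) + sum (λ l → b l * α l j)  ≡⟨ cong₂ _+_ (lc≡sum a j) (lc≡sum b j) ⟨
    lc a α j + lc b α j                                ∎
    where open ≡-Reasoning

  lc-scale : ∀ (s : ℚ) (a : Fin n → ℚ) j → lc (λ l → s * a l) α j ≡ s * lc a α j
  lc-scale s a j = begin
    lc (λ l → s * a l) α j          ≡⟨ lc≡sum (λ l → s * a l) j ⟩
    sum (λ l → s * a l * α l j)     ≡⟨ sum-cong-≗ (λ l → ℚ.*-assoc s (a l) (α l j)) ⟩
    sum (λ l → s * (a l * α l j))   ≡⟨ sym (*-distribˡ-sum s (λ l → a l * α l j)) ⟩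
    s * sum (λ l → a l * α l j)     ≡⟨ cong (s *_) (sym (lc≡sum a j)) ⟩
    s * lc a α j                    ∎
    where open ≡-Reasoning

  lc-distrib-- : ∀ (a b : Fin n → ℚ) j → lc (λ l → a l - b l) α j ≡ lc a α j - lc b α j
  lc-distrib-- a b j = begin
    lc (λ l → a l - b l) α j                ≡⟨ lc-distrib-+ a (λ l → - b l) j ⟩
    lc a α j + lc (λ l → - b l) α j         ≡⟨ cong (lc a α j +_) (lc-cong (λ l → sym (-1*x≈-x (b l))) j) ⟩
    lc a α j + lc (λ l → - 1ℚ * b l) α j    ≡⟨ cong (lc a α j +_) (lc-scale (- 1ℚ) b j) ⟩
    lc a α j + - 1ℚ * lc b α j              ≡⟨ cong (lc a α j +_) (-1*x≈-x (lc b α j)) ⟩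
    lc a α j - lc b α j                     ∎
    where open ≡-Reasoning

  lc-injective : LinIndep α → ∀ {a b : Fin n → ℚ} →
                 (∀ j → lc a α j ≡ lc b α j) → ∀ l → a l ≡ b l
  lc-injective α-indep {a} {b} a≡b l =
    x∙y⁻¹≈ε⇒x≈y (a l) (b l) (α-indep (λ l → a l - b l) a-b≡0 l)
    where
    a-b≡0 : ∀ j → lc (λ l → a l - b l) α j ≡ 0ℚ
    a-b≡0 j = trans (lc-distrib-- a b j) (x≈y⇒x∙y⁻¹≈ε (a≡b j))

extendByZero : ∀ {r n} → r ≤ n → (Fin r → ℚ) → Fin n → ℚ
extendByZero z≤n     k l       = 0ℚ
extendByZero (s≤s p) k zero    = k zero
extendByZero (s≤s p) k (suc l) = extendByZero p (k ∘ suc) l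

extendByZero-elim : ∀ {r n} (p : r ≤ n) (k : Fin r → ℚ) (P : Fin n → ℚ → Set) →
                    (∀ i → P (inject≤ i p) (k i)) → (∀ l → r ≤ toℕ l → P l 0ℚ) →
                    ∀ l → P l (extendByZero p k l)
extendByZero-elim z≤n     k P inside beyond l       = beyond l z≤n
extendByZero-elim (s≤s p) k P inside beyond zero    = inside zero
extendByZero-elim (s≤s p) k P inside beyond (suc l) =
  extendByZero-elim p (k ∘ suc) (P ∘ suc) (inside ∘ suc) (λ l r≤l → beyond (suc l) (s≤s r≤l)) l

extendByZero-inject≤ : ∀ {r n} (p : r ≤ n) (k : Fin r → ℚ) i → extendByZero p k (inject≤ i p) ≡ k i
extendByZero-inject≤ (s≤s p) k zero    = refl
extendByZero-inject≤ (s≤s p) k (suc i) = extendByZero-inject≤ p (k ∘ suc) i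

sum-extendByZero : ∀ {r n} (p : r ≤ n) (k : Fin r → ℚ) (f : Fin n → ℚ) →
                   sum (λ i → k i * f (inject≤ i p)) ≡ sum (λ l → extendByZero p k l * f l)
sum-extendByZero {n = n} z≤n k f =
  sym (trans (sum-cong-≗ (λ l → ℚ.*-zeroˡ (f l))) (sum-replicate-zero n))
sum-extendByZero (s≤s p) k f = cong (k zero * f zero +_) (sum-extendByZero p (k ∘ suc) (f ∘ suc))

gamma≡lc-extendByZero : ∀ {d n r} (p : r ≤ n) (α : Fin n → Pt d) (k : Fin r → ℚ) j →
                        gamma p α k j ≡ lc (extendByZero p k) α j
gamma≡lc-extendByZero p α k j =
  trans (sumFin≡sum (λ i → k i * α (inject≤ i p) j))
        (trans (sum-extendByZero p k (λ l → α l j)) (sym (lc≡sum α (extendByZero p k) j)))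

dropAt-self : ∀ {n} (i : Fin n) (t : Fin n → ℚ) → dropAt i t i ≡ 0ℚ
dropAt-self i t rewrite dec-true (i ≟ i) refl = refl

dropAt-other : ∀ {n} {i l : Fin n} (t : Fin n → ℚ) → l ≢ i → dropAt i t l ≡ t l
dropAt-other {i = i} {l} t l≢i rewrite dec-false (l ≟ i) l≢i = refl

dropAt-nonNeg : ∀ {n} (i : Fin n) {t : Fin n → ℚ} → (∀ l → 0ℚ ℚ.≤ t l) → ∀ l → 0ℚ ℚ.≤ dropAt i t l
dropAt-nonNeg i {t} t≥0 l with l ≟ i
... | yes _ = ℚ.≤-refl
... | no  _ = t≥0 l

p≤p+q : ∀ p {q} → 0ℚ ℚ.≤ q → p ℚ.≤ p + q
p≤p+q p 0≤q = subst (ℚ._≤ p + _) (ℚ.+-identityʳ p) (ℚ.+-monoʳ-≤ p 0≤q)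

p<p+q : ∀ p {q} → 0ℚ < q → p < p + q
p<p+q p 0<q = subst (_< p + _) (ℚ.+-identityʳ p) (ℚ.+-monoʳ-< p 0<q)

p≤q⇒0≤q-p : ∀ {p q} → p ℚ.≤ q → 0ℚ ℚ.≤ q - p
p≤q⇒0≤q-p {p} {q} p≤q = subst (ℚ._≤ q - p) (ℚ.+-inverseʳ p) (ℚ.+-monoˡ-≤ (- p) p≤q)

p<q⇒0<q-p : ∀ {p q} → p < q → 0ℚ < q - p
p<q⇒0<q-p {p} {q} p<q = subst (_< q - p) (ℚ.+-inverseʳ p) (ℚ.+-monoˡ-< (- p) p<q)

module _ (q : ℚ) .{{_ : Positive q}} where

  private instance
    q≢0 : NonZero q
    q≢0 = ℚ.pos⇒nonZero q

    1/q>0 : Positive (1/ q)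
    1/q>0 = ℚ.1/pos⇒pos q

  p÷q*q≡p : ∀ p → p ÷ q * q ≡ p
  p÷q*q≡p p = begin
    p * 1/ q * q     ≡⟨ ℚ.*-assoc p (1/ q) q ⟩
    p * (1/ q * q)   ≡⟨ cong (p *_) (ℚ.*-inverseˡ q) ⟩
    p * 1ℚ           ≡⟨ ℚ.*-identityʳ p ⟩
    p                ∎
    where open ≡-Reasoning

  [p*q+r]÷q≡p+r÷q : ∀ p r → (p * q + r) ÷ q ≡ p + r ÷ q
  [p*q+r]÷q≡p+r÷q p r = begin
    (p * q + r) * 1/ q           ≡⟨ ℚ.*-distribʳ-+ (1/ q) (p * q) r ⟩
    p * q * 1/ q + r * 1/ q      ≡⟨ cong (_+ r ÷ q) (ℚ.*-assoc p q (1/ q)) ⟩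
    p * (q * 1/ q) + r * 1/ q    ≡⟨ cong (λ x → p * x + r ÷ q) (ℚ.*-inverseʳ q) ⟩
    p * 1ℚ + r * 1/ q            ≡⟨ cong (_+ r ÷ q) (ℚ.*-identityʳ p) ⟩
    p + r ÷ q                    ∎
    where open ≡-Reasoning

  ÷-nonNeg : ∀ {p} → 0ℚ ℚ.≤ p → 0ℚ ℚ.≤ p ÷ q
  ÷-nonNeg {p} 0≤p = subst (ℚ._≤ p ÷ q) (ℚ.*-zeroˡ (1/ q))
    (ℚ.*-monoʳ-≤-nonNeg (1/ q) {{ℚ.pos⇒nonNeg (1/ q)}} 0≤p)

  ÷-pos : ∀ {p} → 0ℚ < p → 0ℚ < p ÷ q
  ÷-pos {p} 0<p = subst (_< p ÷ q) (ℚ.*-zeroˡ (1/ q)) (ℚ.*-monoˡ-<-pos (1/ q) 0<p)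

  ≤÷⇒*≤ : ∀ {s p} → s ℚ.≤ p ÷ q → s * q ℚ.≤ p
  ≤÷⇒*≤ {s} {p} s≤p÷q = subst (s * q ℚ.≤_) (p÷q*q≡p p)
    (ℚ.*-monoʳ-≤-nonNeg q {{ℚ.pos⇒nonNeg q}} s≤p÷q)

  <÷⇒*< : ∀ {s p} → s < p ÷ q → s * q < p
  <÷⇒*< {s} {p} s<p÷q = subst (s * q <_) (p÷q*q≡p p) (ℚ.*-monoˡ-<-pos q s<p÷q)

IsFirstArgmin : ∀ {m} → (Fin m → ℚ) → Fin m → Set
IsFirstArgmin f i = (∀ l → f i ℚ.≤ f l) × (∀ l → toℕ l ℕ.< toℕ i → f i < f l)

firstArgmin : ∀ {m} (f : Fin (suc m) → ℚ) → ∃ (IsFirstArgmin f)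
firstArgmin {zero}  f = zero , (λ { zero → ℚ.≤-refl }) , (λ _ ())
firstArgmin {suc m} f with firstArgmin (f ∘ suc)
... | i , i-min , i-first with f zero ℚ.≤? f (suc i)
...   | yes f₀≤ = zero , (λ { zero → ℚ.≤-refl ; (suc l) → ℚ.≤-trans f₀≤ (i-min l) }) , (λ _ ())
...   | no  f₀≰ = suc i , (λ { zero → ℚ.<⇒≤ (ℚ.≰⇒> f₀≰) ; (suc l) → i-min l })
                        , (λ { zero _ → ℚ.≰⇒> f₀≰ ; (suc l) (s≤s l<i) → i-first l l<i })

firstArgmin-≮ : ∀ {m} {f g : Fin m → ℚ} → (∀ l → f l ≡ g l) →
                ∀ {i j} → IsFirstArgmin f i → IsFirstArgmin g j → ¬ toℕ i ℕ.< toℕ j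
firstArgmin-≮ f≗g {i} {j} (i-min , _) (_ , j-first) i<j =
  ℚ.<-irrefl refl (ℚ.<-≤-trans (j-first i i<j) (subst₂ ℚ._≤_ (f≗g i) (f≗g j) (i-min j)))

firstArgmin-unique : ∀ {m} {f g : Fin m → ℚ} → (∀ l → f l ≡ g l) →
                     ∀ {i j} → IsFirstArgmin f i → IsFirstArgmin g j → i ≡ j
firstArgmin-unique f≗g i-first j-first = Fin.toℕ-injective (ℕ.≤-antisym
  (ℕ.≮⇒≥ (firstArgmin-≮ (sym ∘ f≗g) j-first i-first))
  (ℕ.≮⇒≥ (firstArgmin-≮ f≗g i-first j-first)))

module ConeDecomposition {d n r : ℕ} (α : Fin n → Pt d) (p : r ≤ n)
                         (k : Fin r → ℚ) (k>0 : ∀ i → 0ℚ < k i) where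

  private instance
    k-positive : ∀ {i} → Positive (k i)
    k-positive {i} = ℚ.positive (k>0 i)

    k-nonZero : ∀ {i} → NonZero (k i)
    k-nonZero {i} = ℚ.pos⇒nonZero (k i)

  ι : Fin r → Fin n
  ι i = inject≤ i p

  k̃ : Fin n → ℚ
  k̃ = extendByZero p k

  <⇒≢ι : ∀ {l : Fin n} {i} → toℕ l ℕ.< toℕ i → l ≢ ι i
  <⇒≢ι {i = i} l<i refl = ℕ.<-irrefl (Fin.toℕ-inject≤ i p) l<i

  ratio : (Fin n → ℚ) → Fin r → ℚ
  ratio c i = c (ι i) ÷ k i

  coefficients : Fin r → (Fin n → ℚ) → Fin n → ℚ
  coefficients i t l = t (ι i) * k̃ l + dropAt (ι i) t l

  lc-coefficients : ∀ i t j →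
                    lc (coefficients i t) α j ≡ t (ι i) * gamma p α k j + lc (dropAt (ι i) t) α j
  lc-coefficients i t j = begin
    lc (coefficients i t) α j              ≡⟨ lc-distrib-+ α (λ l → s * k̃ l) t′ j ⟩
    lc (λ l → s * k̃ l) α j + lc t′ α j     ≡⟨ cong (_+ lc t′ α j) (lc-scale α s k̃ j) ⟩
    s * lc k̃ α j + lc t′ α j               ≡⟨ cong (λ y → s * y + lc t′ α j) (gamma≡lc-extendByZero p α k j) ⟨
    s * gamma p α k j + lc t′ α j          ∎
    where
    open ≡-Reasoning
    s : ℚ
    s = t (ι i)
    t′ : Fin n → ℚ
    t′ = dropAt (ι i) t

  k̃-nonNeg : ∀ l → 0ℚ ℚ.≤ k̃ l
  k̃-nonNeg = extendByZero-elim p k (λ _ v → 0ℚ ℚ.≤ v) (λ i → ℚ.<⇒≤ (k>0 i)) (λ _ _ → ℚ.≤-refl)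

  coefficients-nonNeg : ∀ i {t} → (∀ l → 0ℚ ℚ.≤ t l) → ∀ l → 0ℚ ℚ.≤ coefficients i t l
  coefficients-nonNeg i {t} t≥0 l =
    ℚ.+-mono-≤ (ℚ.nonNegative⁻¹ (t (ι i) * k̃ l) {{t*k̃≥0}}) (dropAt-nonNeg (ι i) t≥0 l)
    where
    t*k̃≥0 : NonNegative (t (ι i) * k̃ l)
    t*k̃≥0 = ℚ.nonNeg*nonNeg⇒nonNeg (t (ι i)) {{ℚ.nonNegative (t≥0 (ι i))}}
                                   (k̃ l) {{ℚ.nonNegative (k̃-nonNeg l)}}

  ratio-coefficients : ∀ i t l → ratio (coefficients i t) l ≡ t (ι i) + dropAt (ι i) t (ι l) ÷ k l
  ratio-coefficients i t l =
    trans (cong (λ y → (t (ι i) * y + dropAt (ι i) t (ι l)) ÷ k l) (extendByZero-inject≤ p k l))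
          ([p*q+r]÷q≡p+r÷q (k l) (t (ι i)) (dropAt (ι i) t (ι l)))

  InKi⇒minimalRatio : ∀ {i x} → InKi p α k i x →
                      Σ[ x∈K ∈ InCone α x ] IsFirstArgmin (ratio (proj₁ x∈K)) i
  InKi⇒minimalRatio {i} (t , t>0 , t≥0 , x≡) =
    (coefficients i t , coefficients-nonNeg i t≥0 , λ j → trans (x≡ j) (sym (lc-coefficients i t j)))
    , minimal , first
    where
    s : ℚ
    s = t (ι i)

    ρ : Fin r → ℚ
    ρ = ratio (coefficients i t)

    ρᵢ≡s : ρ i ≡ s
    ρᵢ≡s = begin
      ρ i                               ≡⟨ ratio-coefficients i t i ⟩
      s + dropAt (ι i) t (ι i) ÷ k i    ≡⟨ cong (λ y → s + y ÷ k i) (dropAt-self (ι i) t) ⟩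
      s + 0ℚ ÷ k i                      ≡⟨ cong (s +_) (ℚ.*-zeroˡ (1/ k i)) ⟩
      s + 0ℚ                            ≡⟨ ℚ.+-identityʳ s ⟩
      s                                 ∎
      where open ≡-Reasoning

    minimal : ∀ l → ρ i ℚ.≤ ρ l
    minimal l = subst₂ ℚ._≤_ (sym ρᵢ≡s) (sym (ratio-coefficients i t l))
      (p≤p+q s (÷-nonNeg (k l) (dropAt-nonNeg (ι i) t≥0 (ι l))))

    first : ∀ l → toℕ l ℕ.< toℕ i → ρ i < ρ l
    first l l<i = subst₂ _<_ (sym ρᵢ≡s) (sym (ratio-coefficients i t l))
      (p<p+q s (÷-pos (k l) (subst (0ℚ <_) (sym (dropAt-other t (<⇒≢ι ιl<i))) (t>0 (ι l) ιl<i))))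
      where
      ιl<i : toℕ (ι l) ℕ.< toℕ i
      ιl<i = subst (ℕ._< toℕ i) (sym (Fin.toℕ-inject≤ l p)) l<i

  minimalRatio⇒InKi : ∀ {i x} (x∈K : InCone α x) → IsFirstArgmin (ratio (proj₁ x∈K)) i →
                      InKi p α k i x
  minimalRatio⇒InKi {i} {x} (c , c≥0 , x≡) (minimal , first) = t , t>0 , t≥0 , x≡t
    where
    s : ℚ
    s = ratio c i

    u : Fin n → ℚ
    u l = c l - s * k̃ l

    t : Fin n → ℚ
    t = updateAt u (ι i) (const s)

    s*k̃≤c : ∀ l → s * k̃ l ℚ.≤ c l
    s*k̃≤c = extendByZero-elim p k (λ l v → s * v ℚ.≤ c l)
      (λ l → ≤÷⇒*≤ (k l) (minimal l))
      (λ l _ → subst (ℚ._≤ c l) (sym (ℚ.*-zeroʳ s)) (c≥0 l))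

    s*k̃<c : ∀ l → toℕ l ℕ.< toℕ i → s * k̃ l < c l
    s*k̃<c = extendByZero-elim p k (λ l v → toℕ l ℕ.< toℕ i → s * v < c l)
      (λ l ιl<i → <÷⇒*< (k l) (first l (subst (ℕ._< toℕ i) (Fin.toℕ-inject≤ l p) ιl<i)))
      (λ l r≤l l<i → contradiction r≤l (ℕ.<⇒≱ (ℕ.<-trans l<i (Fin.toℕ<n i))))

    uᵢ≡0 : u (ι i) ≡ 0ℚ
    uᵢ≡0 = begin
      c (ι i) - s * k̃ (ι i)   ≡⟨ cong (λ y → c (ι i) - s * y) (extendByZero-inject≤ p k i) ⟩
      c (ι i) - s * k i       ≡⟨ cong (λ y → c (ι i) - y) (p÷q*q≡p (k i) (c (ι i))) ⟩
      c (ι i) - c (ι i)       ≡⟨ ℚ.+-inverseʳ (c (ι i)) ⟩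
      0ℚ                      ∎
      where open ≡-Reasoning

    tᵢ≡s : t (ι i) ≡ s
    tᵢ≡s = updateAt-updates (ι i) u

    t≡u : ∀ {l} → l ≢ ι i → t l ≡ u l
    t≡u {l} l≢ι = updateAt-minimal l (ι i) u l≢ι

    t≥0 : ∀ l → 0ℚ ℚ.≤ t l
    t≥0 l with l ≟ ι i
    ... | yes refl = subst (0ℚ ℚ.≤_) (sym tᵢ≡s) (÷-nonNeg (k i) (c≥0 (ι i)))
    ... | no  l≢ι  = subst (0ℚ ℚ.≤_) (sym (t≡u l≢ι)) (p≤q⇒0≤q-p (s*k̃≤c l))

    t>0 : ∀ l → toℕ l ℕ.< toℕ i → 0ℚ < t l
    t>0 l l<i = subst (0ℚ <_) (sym (t≡u (<⇒≢ι l<i))) (p<q⇒0<q-p (s*k̃<c l l<i))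

    dropAt-t≡u : ∀ l → dropAt (ι i) t l ≡ u l
    dropAt-t≡u l with l ≟ ι i
    ... | yes refl = sym uᵢ≡0
    ... | no  l≢ι  = t≡u l≢ι

    c≡coefficients : ∀ l → c l ≡ coefficients i t l
    c≡coefficients l = begin
      c l                                ≡⟨ solve 3 (λ c s k → c := s :* k :+ (c :+ :- (s :* k))) refl (c l) s (k̃ l) ⟩
      s * k̃ l + u l                      ≡⟨ sym (cong₂ (λ a b → a * k̃ l + b) tᵢ≡s (dropAt-t≡u l)) ⟩
      t (ι i) * k̃ l + dropAt (ι i) t l   ∎
      where open ≡-Reasoning

    x≡t : ∀ j → x j ≡ t (ι i) * gamma p α k j + lc (dropAt (ι i) t) α j
    x≡t j = trans (x≡ j) (trans (lc-cong α c≡coefficients j) (lc-coefficients i t j))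

  InKi⇒InCone : ∀ {i x} → InKi p α k i x → InCone α x
  InKi⇒InCone = proj₁ ∘ InKi⇒minimalRatio

  InKi-unique : LinIndep α → ∀ {i j x} → InKi p α k i x → InKi p α k j x → i ≡ j
  InKi-unique α-indep x∈Kᵢ x∈Kⱼ
    with (c , _ , x≡c) , c-min ← InKi⇒minimalRatio x∈Kᵢ
       | (c′ , _ , x≡c′) , c′-min ← InKi⇒minimalRatio x∈Kⱼ
    = firstArgmin-unique (λ l → cong (_÷ k l) (c≡c′ (ι l))) c-min c′-min
    where
    c≡c′ : ∀ l → c l ≡ c′ l
    c≡c′ = lc-injective α α-indep (λ j → trans (sym (x≡c j)) (x≡c′ j))

proposition3p5 : (d n : ℕ) (α : Fin n → Pt d) → LinIndep α →
    (r : ℕ) → 1 ≤ r → (r≤n : r ≤ n) →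
    (k : Fin r → ℚ) → (∀ i → 0ℚ < k i) →
    σ-sum-eq (InCone α) (λ i → InKi r≤n α k i)
proposition3p5 d n α α-indep (suc m) (s≤s z≤n) r≤n k k>0 x = partition , λ _ → InKi⇒InCone
  where
  open ConeDecomposition α r≤n k k>0

  partition : InCone α (toℚ x) →
              Σ[ i ∈ Fin (suc m) ] InKi r≤n α k i (toℚ x) × (∀ j → InKi r≤n α k j (toℚ x) → j ≡ i)
  partition x∈K with i , i-argmin ← firstArgmin (ratio (proj₁ x∈K)) =
    i , x∈Kᵢ , λ j x∈Kⱼ → InKi-unique α-indep x∈Kⱼ x∈Kᵢ
    where
    x∈Kᵢ : InKi r≤n α k i (toℚ x)
    x∈Kᵢ = minimalRatio⇒InKi x∈K i-argmin
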